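{- Let $m\ge 1$ and $c\ge 1$, and for each department $d\in[c]$ let $k_{d,1},\dots,k_{d,n_d}\in\{0,\dots,m\}$. All committees are chosen independently: department $d$ chooses, for each $l\in[n_d]$, a uniformly random subset of $[m]$ of size $k_{d,l}$. Let $X_\cap$ be the number of elements of $[m]$ lying in at least one committee of every department. Then for $0\le i\le m$, $$\mathbb{P}[X_\cap=i]=\binom{m}{i}\Delta^{m-i}\Big\{\prod_{d=1}^c\nabla^{m-y}\Big[\prod_{l=1}^{n_d}\frac{\binom{x}{k_{d,l}}}{\binom{m}{k_{d,l}}}\Big]_{x=m}\Big\}_{y=0},$$ and for $r\ge 0$, $$\mathbb{E}\Big[\binom{X_\cap}{r}\Big]=\binom{m}{r}\prod_{d=1}^c\nabla^r\Big\{\prod_{l=1}^{n_d}\frac{\binom{x}{k_{d,l}}}{\binom{m}{k_{d,l}}}\Big\}_{x=m}.$$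
   Context: $\nabla f(x)=f(x)-f(x-1)$ and $\Delta f(x)=f(x+1)-f(x)$ are the backward and forward difference operators with iterates; $\nabla^{m-y}$ acts on $x$ (evaluated at $x=m$) and $\Delta^{m-i}$ acts on $y$ (evaluated at $y=0$); $\binom{x}{k}=x(x-1)\cdots(x-k+1)/k!$. -}

module Defs where

open import Data.Nat as ℕ using (ℕ; zero; suc)
open import Data.Nat.Combinatorics using (_C_)
open import Data.Integer as ℤ using (ℤ; +_)
open import Data.Rational as ℚ using (ℚ; 0ℚ; 1ℚ; _/_)
open import Data.Fin using (Fin; zero; suc)
open import Data.Fin.Subset using (Subset; ⋃; ⋂; ∣_∣; inside; outside)
open import Data.Vec using (Vec; []; _∷_)
open import Data.List as List using (List; []; _∷_; _++_; concatMap; map; length; filter; tabulate)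
open import Relation.Binary.PropositionalEquality using (_≡_)

allSubsets : (m : ℕ) → List (Subset m)
allSubsets zero    = [] ∷ []
allSubsets (suc m) = concatMap (λ s → (inside ∷ s) ∷ (outside ∷ s) ∷ []) (allSubsets m)

subsetsOfSize : (m k : ℕ) → List (Subset m)
subsetsOfSize m k = filter (λ s → ∣ s ∣ ℕ.≟ k) (allSubsets m)

allChoices : (n : ℕ) {A : Fin n → Set} → ((j : Fin n) → List (A j)) → List ((j : Fin n) → A j)
allChoices zero    opts = (λ ()) ∷ []
allChoices (suc n) opts =
  concatMap (λ a → map (λ f → λ { zero → a ; (suc j) → f j })
                       (allChoices n (λ j → opts (suc j))))
            (opts zero)

-- The committee model.  c departments, department d has n d committees,
-- committee l of department d is a subset of [m] of size k d l.

Outcome : (m c : ℕ) (n : Fin c → ℕ) → Set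
Outcome m c n = (d : Fin c) → Fin (n d) → Subset m

-- sample space: all committee configurations (uniform, independent choices
-- = uniform measure on this product)
Ω : (m c : ℕ) (n : Fin c → ℕ) (k : (d : Fin c) → Fin (n d) → ℕ) → List (Outcome m c n)
Ω m c n k = allChoices c (λ d → allChoices (n d) (λ l → subsetsOfSize m (k d l)))

Xcap : {m c : ℕ} {n : Fin c → ℕ} → Outcome m c n → ℕ
Xcap {m} {c} {n} ω = ∣ ⋂ (tabulate (λ d → ⋃ (tabulate (λ l → ω d l)))) ∣

-- 1/n as a rational (with 1/0 := 0; only used with n > 0)
recipℕ : ℕ → ℚ
recipℕ zero    = 0ℚ
recipℕ (suc n) = + 1 / suc n

ℕtoℚ : ℕ → ℚ
ℕtoℚ n = + n / 1

sumℚ : List ℚ → ℚ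
sumℚ = List.foldr ℚ._+_ 0ℚ

probXcap : (m c : ℕ) (n : Fin c → ℕ) (k : (d : Fin c) → Fin (n d) → ℕ) → ℕ → ℚ
probXcap m c n k i =
  ℕtoℚ (length (filter (λ ω → Xcap ω ℕ.≟ i) (Ω m c n k))) ℚ.* recipℕ (length (Ω m c n k))

expBinomXcap : (m c : ℕ) (n : Fin c → ℕ) (k : (d : Fin c) → Fin (n d) → ℕ) → ℕ → ℚ
expBinomXcap m c n k r =
  sumℚ (map (λ ω → ℕtoℚ (Xcap ω C r)) (Ω m c n k)) ℚ.* recipℕ (length (Ω m c n k))

gbinom : ℤ → ℕ → ℚ
gbinom x zero    = 1ℚ
gbinom x (suc k) = gbinom x k ℚ.* ((x ℤ.- + k) / suc k)

prodFin : (n : ℕ) → (Fin n → ℚ) → ℚ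
prodFin zero    f = 1ℚ
prodFin (suc n) f = f zero ℚ.* prodFin n (λ j → f (suc j))

∇ : (ℤ → ℚ) → ℤ → ℚ
∇ f x = f x ℚ.- f (x ℤ.- + 1)

∇^ : ℕ → (ℤ → ℚ) → ℤ → ℚ
∇^ zero    f = f
∇^ (suc j) f = ∇ (∇^ j f)

-- forward difference Δ g (y) = g (y + 1) - g y, and iterates (y ∈ ℕ suffices: evaluated at y = 0)
Δ : (ℕ → ℚ) → ℕ → ℚ
Δ g y = g (suc y) ℚ.- g y

Δ^ : ℕ → (ℕ → ℚ) → ℕ → ℚ
Δ^ zero    g = g
Δ^ (suc j) g = Δ (Δ^ j g)

Fdep : (m c : ℕ) (n : Fin c → ℕ) (k : (d : Fin c) → Fin (n d) → ℕ) → Fin c → ℤ → ℚ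
Fdep m c n k d x = prodFin (n d) (λ l → gbinom x (k d l) ℚ.* recipℕ (m C k d l))

module Submission where

-- Every probability is a finite sum over the enumerated sample space, and every
-- indicator of a relation between subsets of [m] is a product of coordinatewise
-- weights, so sums over all subsets of [m] are evaluated by induction on m.
-- With E(r) = ∏_d ∇ʳ F_d (m):
--   · by independence and inclusion–exclusion over S ⊆ R,
--     #{ω : R ⊆ X ω} = ∏_d Σ_{S ⊆ R} (-1)^∣S∣ ∏_l C(m - ∣S∣, k_{d,l}) = ∣Ω∣ · E(∣R∣);
--   · C(∣X∣, r) = Σ_{∣R∣ = r} [R ⊆ X] gives the binomial moments;
--   · Möbius inversion [D = X] = Σ_{R ⊇ D} (-1)^∣R∖D∣ [R ⊆ X] and the identity
--     Σ_{R ⊇ D} (-1)^∣R∖D∣ E(∣R∣) = Δ^(m-∣D∣) (y ↦ E(m - y)) (0) give P[X_∩ = i].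

open import Defs
open import Data.Bool using (Bool; true; false; not; _∧_; _∨_; if_then_else_)
open import Data.Nat as ℕ using (ℕ; zero; suc; _≤_; _∸_; s≤s)
import Data.Nat.Properties as ℕP
open import Data.Nat.Combinatorics using (_C_; nCk+nC[k+1]≡[n+1]C[k+1]; k>n⇒nCk≡0; nC1≡n)
open import Data.Integer as ℤ using (ℤ; +_)
import Data.Integer.Properties as ℤP
open import Data.Integer.Solver using () renaming (module +-*-Solver to ℤ-Solver)
open import Data.Rational as ℚ using (ℚ; 0ℚ; 1ℚ; _+_; _*_; -_; _-_; _/_)
import Data.Rational.Properties as ℚP
open import Data.Rational.Solver using (module +-*-Solver)
open import Data.Rational.Unnormalised as ℚᵘ using (ℚᵘ; mkℚᵘ; *≡*)
import Data.Rational.Unnormalised.Properties as ℚᵘP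
open import Data.Fin using (Fin; zero; suc)
open import Data.Fin.Subset using (Subset; ⋃; ⋂; ∣_∣; ∁; ⊤)
open import Data.Fin.Subset.Properties using (∣∁p∣≡n∸∣p∣; ∣p∣≤n; ∣⊤∣≡n)
open import Data.Vec using ([]; _∷_; replicate; zipWith)
open import Data.List as List using (List; []; _∷_; _++_; concatMap; map; length; filter; tabulate)
import Data.List.Properties as ListP
open import Data.Product using (_×_; _,_)
open import Function using (flip)
open import Relation.Nullary using (Dec; does; yes; no)
open import Relation.Unary using (Pred; Decidable)
open import Relation.Binary.PropositionalEquality

-- Two rationals are equal as soon as their unnormalised images are
-- equivalent to equivalent fractions; this reduces every identity about
-- ℕtoℚ n = n/1 below to an identity between integers.
via-ℚᵘ : ∀ {p q : ℚ} {u v : ℚᵘ} →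
         ℚ.toℚᵘ p ℚᵘ.≃ u → ℚ.toℚᵘ q ℚᵘ.≃ v → u ℚᵘ.≃ v → p ≡ q
via-ℚᵘ p≃u q≃v u≃v = ℚP.toℚᵘ-injective (≃-trans p≃u (≃-trans u≃v (≃-sym q≃v)))
  where open ℚᵘP using (≃-trans; ≃-sym)

ℕtoℚ≃ : ∀ n → ℚ.toℚᵘ (ℕtoℚ n) ℚᵘ.≃ mkℚᵘ (+ n) 0
ℕtoℚ≃ n = ℚP.toℚᵘ-fromℚᵘ (mkℚᵘ (+ n) 0)

ℕtoℚ-+ : ∀ a b → ℕtoℚ (a ℕ.+ b) ≡ ℕtoℚ a + ℕtoℚ b
ℕtoℚ-+ a b = via-ℚᵘ (ℕtoℚ≃ (a ℕ.+ b))
  (ℚᵘP.≃-trans (ℚP.toℚᵘ-homo-+ (ℕtoℚ a) (ℕtoℚ b)) (ℚᵘP.+-cong (ℕtoℚ≃ a) (ℕtoℚ≃ b)))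
  (*≡* (trans (cong (ℤ._* + 1) (ℤP.pos-+ a b))
    (solve 2 (λ x y → (x :+ y) :* con (+ 1) := (x :* con (+ 1) :+ y :* con (+ 1)) :* con (+ 1))
           refl (+ a) (+ b))))
  where open ℤ-Solver

ℕtoℚ-injective : ∀ {a b} → ℕtoℚ a ≡ ℕtoℚ b → a ≡ b
ℕtoℚ-injective {a} {b} eq
  with ℚᵘP.≃-trans (ℚᵘP.≃-sym (ℕtoℚ≃ a)) (ℚᵘP.≃-trans (ℚP.toℚᵘ-cong eq) (ℕtoℚ≃ b))
... | *≡* a*1≡b*1 = ℤP.+-injective (trans (sym (ℤP.*-identityʳ (+ a))) (trans a*1≡b*1 (ℤP.*-identityʳ (+ b))))

ℕtoℚ-*-fraction : ∀ a b c k → c ℕ.* suc k ≡ a ℕ.* b → ℕtoℚ a * (+ b / suc k) ≡ ℕtoℚ c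
ℕtoℚ-*-fraction a b c k eq = via-ℚᵘ
  (ℚᵘP.≃-trans (ℚP.toℚᵘ-homo-* (ℕtoℚ a) (+ b / suc k))
               (ℚᵘP.*-cong (ℕtoℚ≃ a) (ℚP.toℚᵘ-fromℚᵘ (mkℚᵘ (+ b) k))))
  (ℕtoℚ≃ c)
  (*≡* (begin
    (+ a ℤ.* + b) ℤ.* + 1   ≡⟨ ℤP.*-identityʳ _ ⟩
    + a ℤ.* + b             ≡⟨ ℤP.pos-* a b ⟨
    + (a ℕ.* b)             ≡⟨ cong +_ eq ⟨
    + (c ℕ.* suc k)         ≡⟨ ℤP.pos-* c (suc k) ⟩
    + c ℤ.* + suc k         ≡⟨ cong (λ d → + c ℤ.* + d) (ℕP.*-identityˡ (suc k)) ⟨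
    + c ℤ.* + (1 ℕ.* suc k) ∎))
  where open ≡-Reasoning

ℕtoℚ-cancel : ∀ N g → 1 ≤ N → ℕtoℚ N * (g * recipℕ N) ≡ g
ℕtoℚ-cancel (suc N) g _ = begin
  ℕtoℚ (suc N) * (g * recipℕ (suc N))   ≡⟨ ℚP.*-comm (ℕtoℚ (suc N)) _ ⟩
  (g * recipℕ (suc N)) * ℕtoℚ (suc N)   ≡⟨ ℚP.*-assoc g _ _ ⟩
  g * (recipℕ (suc N) * ℕtoℚ (suc N))   ≡⟨ cong (g *_) (trans (ℚP.*-comm (recipℕ (suc N)) _)
                                                             (ℕtoℚ-*-fraction (suc N) 1 1 N (ℕP.*-comm 1 (suc N)))) ⟩
  g * 1ℚ                                ≡⟨ ℚP.*-identityʳ g ⟩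
  g                                     ∎
  where open ≡-Reasoning

C-positive : ∀ m k → k ≤ m → 1 ≤ m C k
C-positive m       zero    _         = ℕP.≤-refl
C-positive (suc m) (suc k) (s≤s k≤m) =
  ℕP.≤-trans (C-positive m k k≤m)
    (ℕP.≤-trans (ℕP.m≤m+n (m C k) _) (ℕP.≤-reflexive (nCk+nC[k+1]≡[n+1]C[k+1] m k)))

C-absorption : ∀ u k → (u C suc k) ℕ.* suc k ≡ (u C k) ℕ.* (u ∸ k)
C-absorption zero    k       = sym (trans (cong ((0 C k) ℕ.*_) (ℕP.0∸n≡0 k)) (ℕP.*-zeroʳ (0 C k)))
C-absorption (suc u) zero    = trans (ℕP.*-identityʳ _) (trans (nC1≡n (suc u)) (sym (ℕP.+-identityʳ _)))
C-absorption (suc u) (suc k) = begin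
  (suc u C suc (suc k)) ℕ.* suc (suc k)          ≡⟨ cong (ℕ._* suc (suc k)) (nCk+nC[k+1]≡[n+1]C[k+1] u (suc k)) ⟨
  (a ℕ.+ u C suc (suc k)) ℕ.* suc (suc k)        ≡⟨ ℕP.*-distribʳ-+ (suc (suc k)) a _ ⟩
  a ℕ.* suc (suc k) ℕ.+ (u C suc (suc k)) ℕ.* suc (suc k)
                                                 ≡⟨ cong (a ℕ.* suc (suc k) ℕ.+_) (C-absorption u (suc k)) ⟩
  a ℕ.* suc (suc k) ℕ.+ a ℕ.* (u ∸ suc k)        ≡⟨ ℕP.*-distribˡ-+ a (suc (suc k)) (u ∸ suc k) ⟨
  a ℕ.* (suc (suc k) ℕ.+ (u ∸ suc k))            ≡⟨ regroup ⟩
  a ℕ.* (suc k ℕ.+ (u ∸ k))                      ≡⟨ ℕP.*-distribˡ-+ a (suc k) (u ∸ k) ⟩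
  a ℕ.* suc k ℕ.+ a ℕ.* (u ∸ k)                  ≡⟨ cong (ℕ._+ a ℕ.* (u ∸ k)) (C-absorption u k) ⟩
  (u C k) ℕ.* (u ∸ k) ℕ.+ a ℕ.* (u ∸ k)          ≡⟨ ℕP.*-distribʳ-+ (u ∸ k) (u C k) a ⟨
  (u C k ℕ.+ a) ℕ.* (u ∸ k)                      ≡⟨ cong (ℕ._* (u ∸ k)) (nCk+nC[k+1]≡[n+1]C[k+1] u k) ⟩
  (suc u C suc k) ℕ.* (suc u ∸ suc k)            ∎
  where
  open ≡-Reasoning
  a : ℕ
  a = u C suc k
  -- both factors equal  a·(u+1)  when k < u, and a = 0 otherwise
  regroup : a ℕ.* (suc (suc k) ℕ.+ (u ∸ suc k)) ≡ a ℕ.* (suc k ℕ.+ (u ∸ k))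
  regroup with suc k ℕ.≤? u
  ... | yes k<u = cong (λ s → a ℕ.* suc s)
                    (trans (ℕP.m+[n∸m]≡n k<u) (sym (ℕP.m+[n∸m]≡n (ℕP.<⇒≤ k<u))))
  ... | no  k≮u rewrite k>n⇒nCk≡0 (ℕP.≰⇒> k≮u) = refl

gbinom-ℕ : ∀ u k → gbinom (+ u) k ≡ ℕtoℚ (u C k)
gbinom-ℕ u zero    = refl
gbinom-ℕ u (suc k) with k ℕ.≤? u
... | yes k≤u = begin
  gbinom (+ u) k * ((+ u ℤ.- + k) / suc k)   ≡⟨ cong₂ (λ b d → b * (d / suc k)) (gbinom-ℕ u k) u-k≡ ⟩
  ℕtoℚ (u C k) * (+ (u ∸ k) / suc k)         ≡⟨ ℕtoℚ-*-fraction (u C k) (u ∸ k) (u C suc k) k (C-absorption u k) ⟩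
  ℕtoℚ (u C suc k)                           ∎
  where
  open ≡-Reasoning
  u-k≡ : + u ℤ.- + k ≡ + (u ∸ k)
  u-k≡ = trans (ℤP.[+m]-[+n]≡m⊖n u k) (ℤP.⊖-≥ k≤u)
... | no  k≰u = begin
  gbinom (+ u) k * ((+ u ℤ.- + k) / suc k)   ≡⟨ cong (_* ((+ u ℤ.- + k) / suc k))
                                                     (trans (gbinom-ℕ u k) (cong ℕtoℚ (k>n⇒nCk≡0 u<k))) ⟩
  0ℚ * ((+ u ℤ.- + k) / suc k)               ≡⟨ ℚP.*-zeroˡ ((+ u ℤ.- + k) / suc k) ⟩
  0ℚ                                         ≡⟨ cong ℕtoℚ (k>n⇒nCk≡0 (ℕP.m<n⇒m<1+n u<k)) ⟨
  ℕtoℚ (u C suc k)                           ∎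
  where
  open ≡-Reasoning
  u<k : u ℕ.< k
  u<k = ℕP.≰⇒> k≰u

∑ : ∀ {a} {A : Set a} → List A → (A → ℚ) → ℚ
∑ L f = sumℚ (map f L)

syntax ∑ L (λ x → e) = ∑[ x ← L ] e

𝟙 : ∀ {p} {P : Set p} → Dec P → ℚ
𝟙 P? = if does P? then 1ℚ else 0ℚ

𝟙-≡ : ∀ {a} {A : Set a} {x y : A} (x≟y : Dec (x ≡ y)) (g : A → ℚ) → 𝟙 x≟y * g x ≡ 𝟙 x≟y * g y
𝟙-≡ (yes refl) g = refl
𝟙-≡ {x = x} {y} (no _) g = trans (ℚP.*-zeroˡ (g x)) (sym (ℚP.*-zeroˡ (g y)))

module _ {a} {A : Set a} where

  ∑-cong : ∀ (L : List A) {f g : A → ℚ} → (∀ x → f x ≡ g x) → ∑ L f ≡ ∑ L g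
  ∑-cong []      f≗g = refl
  ∑-cong (x ∷ L) f≗g = cong₂ _+_ (f≗g x) (∑-cong L f≗g)

  ∑-++ : ∀ (L M : List A) (f : A → ℚ) → ∑ (L ++ M) f ≡ ∑ L f + ∑ M f
  ∑-++ []      M f = sym (ℚP.+-identityˡ _)
  ∑-++ (x ∷ L) M f = trans (cong (λ s → f x + s) (∑-++ L M f)) (sym (ℚP.+-assoc (f x) _ _))

  ∑-+ : ∀ (L : List A) (f g : A → ℚ) → ∑[ x ← L ] (f x + g x) ≡ ∑ L f + ∑ L g
  ∑-+ []      f g = refl
  ∑-+ (x ∷ L) f g = trans (cong (λ s → f x + g x + s) (∑-+ L f g))
    (solve 4 (λ a b c d → (a :+ b) :+ (c :+ d) := (a :+ c) :+ (b :+ d)) refl (f x) (g x) (∑ L f) (∑ L g))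
    where open +-*-Solver

  ∑-*ˡ : ∀ (L : List A) (c : ℚ) (f : A → ℚ) → ∑[ x ← L ] (c * f x) ≡ c * ∑ L f
  ∑-*ˡ []      c f = sym (ℚP.*-zeroʳ c)
  ∑-*ˡ (x ∷ L) c f = trans (cong (λ s → c * f x + s) (∑-*ˡ L c f)) (sym (ℚP.*-distribˡ-+ c (f x) _))

  ∑-*ʳ : ∀ (L : List A) (c : ℚ) (f : A → ℚ) → ∑[ x ← L ] (f x * c) ≡ ∑ L f * c
  ∑-*ʳ L c f = trans (∑-cong L (λ x → ℚP.*-comm (f x) c)) (trans (∑-*ˡ L c f) (ℚP.*-comm c _))

  ∑-zero : ∀ (L : List A) → ∑[ x ← L ] 0ℚ ≡ 0ℚ
  ∑-zero []      = refl
  ∑-zero (x ∷ L) = trans (ℚP.+-identityˡ _) (∑-zero L)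

  ∑-filter : ∀ {p} {P : Pred A p} (P? : Decidable P) (L : List A) (f : A → ℚ) →
             ∑ (filter P? L) f ≡ ∑[ x ← L ] (𝟙 (P? x) * f x)
  ∑-filter P? []      f = refl
  ∑-filter P? (x ∷ L) f with does (P? x)
  ... | true  = cong₂ _+_ (sym (ℚP.*-identityˡ (f x))) (∑-filter P? L f)
  ... | false = trans (∑-filter P? L f) (sym (trans (cong (_+ _) (ℚP.*-zeroˡ (f x))) (ℚP.+-identityˡ _)))

  length-∑ : ∀ (L : List A) → ℕtoℚ (length L) ≡ ∑[ x ← L ] 1ℚ
  length-∑ []      = refl
  length-∑ (x ∷ L) = trans (ℕtoℚ-+ 1 (length L)) (cong (λ s → 1ℚ + s) (length-∑ L))

module _ {a b} {A : Set a} {B : Set b} where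

  ∑-map : ∀ (L : List A) (g : A → B) (f : B → ℚ) → ∑ (map g L) f ≡ ∑[ x ← L ] f (g x)
  ∑-map []      g f = refl
  ∑-map (x ∷ L) g f = cong (λ s → f (g x) + s) (∑-map L g f)

  ∑-concatMap : ∀ (L : List A) (g : A → List B) (f : B → ℚ) →
                ∑ (concatMap g L) f ≡ ∑[ x ← L ] ∑ (g x) f
  ∑-concatMap []      g f = refl
  ∑-concatMap (x ∷ L) g f = trans (∑-++ (g x) (concatMap g L) f) (cong (λ s → ∑ (g x) f + s) (∑-concatMap L g f))

  ∑-swap : ∀ (L : List A) (M : List B) (f : A → B → ℚ) →
           ∑[ x ← L ] ∑[ y ← M ] f x y ≡ ∑[ y ← M ] ∑[ x ← L ] f x y
  ∑-swap []      M f = sym (∑-zero M)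
  ∑-swap (x ∷ L) M f = trans (cong (λ s → ∑ M (f x) + s) (∑-swap L M f)) (sym (∑-+ M (f x) _))

∑-*-pull : ∀ {a} {A : Set a} (L : List A) (c : ℚ) (f g : A → ℚ) →
           ∑[ x ← L ] ((c * f x) * g x) ≡ c * ∑[ x ← L ] (f x * g x)
∑-*-pull L c f g = trans (∑-cong L (λ x → ℚP.*-assoc c (f x) (g x))) (∑-*ˡ L c (λ x → f x * g x))

∑-*-middle : ∀ {a} {A : Set a} (L : List A) (c : ℚ) (f g : A → ℚ) →
             ∑[ x ← L ] (f x * (c * g x)) ≡ c * ∑[ x ← L ] (f x * g x)
∑-*-middle L c f g = trans (∑-cong L (λ x → solve 3 (λ a c b → a :* (c :* b) := c :* (a :* b)) refl (f x) c (g x)))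
                           (∑-*ˡ L c (λ x → f x * g x))
  where open +-*-Solver

∏-cong : ∀ n {f g : Fin n → ℚ} → (∀ j → f j ≡ g j) → prodFin n f ≡ prodFin n g
∏-cong zero    f≗g = refl
∏-cong (suc n) f≗g = cong₂ _*_ (f≗g zero) (∏-cong n (λ j → f≗g (suc j)))

∏-* : ∀ n (f g : Fin n → ℚ) → prodFin n (λ j → f j * g j) ≡ prodFin n f * prodFin n g
∏-* zero    f g = sym (ℚP.*-identityˡ 1ℚ)
∏-* (suc n) f g = trans (cong (f zero * g zero *_) (∏-* n (λ j → f (suc j)) (λ j → g (suc j))))
  (solve 4 (λ a b c d → (a :* b) :* (c :* d) := (a :* c) :* (b :* d)) refl (f zero) (g zero) _ _)
  where open +-*-Solver

∏-one : ∀ n → prodFin n (λ _ → 1ℚ) ≡ 1ℚ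
∏-one zero    = refl
∏-one (suc n) = trans (ℚP.*-identityˡ _) (∏-one n)

∑-allChoices : ∀ n {A : Fin n → Set} (opts : (j : Fin n) → List (A j)) (g : (j : Fin n) → A j → ℚ) →
  ∑[ f ← allChoices n opts ] prodFin n (λ j → g j (f j)) ≡ prodFin n (λ j → ∑ (opts j) (g j))
∑-allChoices zero    opts g = refl
∑-allChoices (suc n) {A} opts g = begin
  ∑[ f ← allChoices (suc n) opts ] prodFin (suc n) (λ j → g j (f j))
    ≡⟨ trans (∑-concatMap (opts zero) _ _) (∑-cong (opts zero) (λ a → ∑-map rest _ _)) ⟩
  ∑[ a ← opts zero ] ∑[ f ← rest ] (g zero a * prodFin n (λ j → g (suc j) (f j)))
    ≡⟨ ∑-cong (opts zero) (λ a → ∑-*ˡ rest (g zero a) (λ f → prodFin n (λ j → g (suc j) (f j)))) ⟩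
  ∑[ a ← opts zero ] (g zero a * ∑[ f ← rest ] prodFin n (λ j → g (suc j) (f j)))
    ≡⟨ ∑-cong (opts zero) (λ a → cong (g zero a *_) (∑-allChoices n (λ j → opts (suc j)) (λ j → g (suc j)))) ⟩
  ∑[ a ← opts zero ] (g zero a * prodFin n (λ j → ∑ (opts (suc j)) (g (suc j))))
    ≡⟨ ∑-*ʳ (opts zero) _ (g zero) ⟩
  ∑ (opts zero) (g zero) * prodFin n (λ j → ∑ (opts (suc j)) (g (suc j)))  ∎
  where
  open ≡-Reasoning
  rest : List ((j : Fin n) → A (suc j))
  rest = allChoices n (λ j → opts (suc j))

allChoices-length : ∀ n {A : Fin n → Set} (opts : (j : Fin n) → List (A j)) →
  ℕtoℚ (length (allChoices n opts)) ≡ prodFin n (λ j → ℕtoℚ (length (opts j)))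
allChoices-length n opts = begin
  ℕtoℚ (length (allChoices n opts))                        ≡⟨ length-∑ (allChoices n opts) ⟩
  ∑[ f ← allChoices n opts ] 1ℚ                             ≡⟨ ∑-cong (allChoices n opts) (λ _ → sym (∏-one n)) ⟩
  ∑[ f ← allChoices n opts ] prodFin n (λ _ → 1ℚ)           ≡⟨ ∑-allChoices n opts (λ _ _ → 1ℚ) ⟩
  prodFin n (λ j → ∑[ a ← opts j ] 1ℚ)                      ≡⟨ ∏-cong n (λ j → sym (length-∑ (opts j))) ⟩
  prodFin n (λ j → ℕtoℚ (length (opts j)))                  ∎
  where open ≡-Reasoning

allChoices-nonempty : ∀ n {A : Fin n → Set} (opts : (j : Fin n) → List (A j)) →
  (∀ j → 1 ≤ length (opts j)) → 1 ≤ length (allChoices n opts)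
allChoices-nonempty zero    opts _ = ℕP.≤-refl
allChoices-nonempty (suc n) {A} opts nonempty with opts zero | nonempty zero
... | a ∷ _ | _ = ℕP.≤-trans tails-nonempty
  (ℕP.≤-trans (ℕP.m≤m+n _ _) (ℕP.≤-reflexive (sym (ListP.length-++ (map _ rest)))))
  where
  rest : List ((j : Fin n) → A (suc j))
  rest = allChoices n (λ j → opts (suc j))
  tails-nonempty : 1 ≤ length (map _ rest)
  tails-nonempty = ℕP.≤-trans (allChoices-nonempty n (λ j → opts (suc j)) (λ j → nonempty (suc j)))
                              (ℕP.≤-reflexive (sym (ListP.length-map _ rest)))

∑-allSubsets-suc : ∀ m (f : Subset (suc m) → ℚ) →
  ∑ (allSubsets (suc m)) f ≡ ∑[ S ← allSubsets m ] f (true ∷ S) + ∑[ S ← allSubsets m ] f (false ∷ S)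
∑-allSubsets-suc m f = trans (∑-concatMap (allSubsets m) _ f)
  (trans (∑-cong (allSubsets m) (λ S → cong (λ s → f (true ∷ S) + s) (ℚP.+-identityʳ (f (false ∷ S)))))
         (∑-+ (allSubsets m) _ _))

-- A coordinatewise weight w : Bool → Bool → ℚ induces the weight
-- ∏ᵢ w (Aᵢ) (Bᵢ) of a pair of subsets; all indicators of set relations
-- used below are of this form.
weight : ∀ {m} → (Bool → Bool → ℚ) → Subset m → Subset m → ℚ
weight w []      []      = 1ℚ
weight w (a ∷ A) (b ∷ B) = w a b * weight w A B

weight-cong : ∀ {v w : Bool → Bool → ℚ} → (∀ a b → v a b ≡ w a b) →
              ∀ {m} (A B : Subset m) → weight v A B ≡ weight w A B
weight-cong v≗w []      []      = refl
weight-cong v≗w (a ∷ A) (b ∷ B) = cong₂ _*_ (v≗w a b) (weight-cong v≗w A B)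

weight-flip : ∀ (w : Bool → Bool → ℚ) {m} (A B : Subset m) → weight w A B ≡ weight (flip w) B A
weight-flip w []      []      = refl
weight-flip w (a ∷ A) (b ∷ B) = cong (w a b *_) (weight-flip w A B)

weight-step : ∀ (w : Bool → Bool → ℚ) a {m} (A : Subset m) (h : Subset (suc m) → ℚ) →
  ∑[ S ← allSubsets (suc m) ] (weight w (a ∷ A) S * h S)
    ≡ w a true  * ∑[ S ← allSubsets m ] (weight w A S * h (true ∷ S))
    + w a false * ∑[ S ← allSubsets m ] (weight w A S * h (false ∷ S))
weight-step w a {m} A h = trans (∑-allSubsets-suc m (λ S → weight w (a ∷ A) S * h S))
  (cong₂ _+_ (∑-*-pull (allSubsets m) (w a true)  (weight w A) (λ S → h (true ∷ S)))
             (∑-*-pull (allSubsets m) (w a false) (weight w A) (λ S → h (false ∷ S))))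

-- Kronecker product rule: summing a product of two weights over the
-- middle subset multiplies the coordinatewise 2×2 matrices.
weight-compose : ∀ (u v : Bool → Bool → ℚ) {m} (A B : Subset m) →
  ∑[ S ← allSubsets m ] (weight u A S * weight v S B)
    ≡ weight (λ a b → u a true * v true b + u a false * v false b) A B
weight-compose u v {zero}  []      []      = ℚP.+-identityʳ (1ℚ * 1ℚ)
weight-compose u v {suc m} (a ∷ A) (b ∷ B) = begin
  ∑[ S ← allSubsets (suc m) ] (weight u (a ∷ A) S * weight v S (b ∷ B))
    ≡⟨ weight-step u a A (λ S → weight v S (b ∷ B)) ⟩
  u a true * ∑[ S ← allSubsets m ] (weight u A S * (v true b * weight v S B))
    + u a false * ∑[ S ← allSubsets m ] (weight u A S * (v false b * weight v S B))
    ≡⟨ cong₂ (λ x y → u a true * x + u a false * y) (∑-*-middle (allSubsets m) (v true b) (weight u A) (λ S → weight v S B))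
                                                          (∑-*-middle (allSubsets m) (v false b) (weight u A) (λ S → weight v S B)) ⟩
  u a true * (v true b * Σ) + u a false * (v false b * Σ)
    ≡⟨ solve 5 (λ p q r s σ → p :* (q :* σ) :+ r :* (s :* σ) := (p :* q :+ r :* s) :* σ) refl
             (u a true) (v true b) (u a false) (v false b) Σ ⟩
  (u a true * v true b + u a false * v false b) * Σ
    ≡⟨ cong ((u a true * v true b + u a false * v false b) *_) (weight-compose u v A B) ⟩
  weight (λ a b → u a true * v true b + u a false * v false b) (a ∷ A) (b ∷ B) ∎
  where
  open ≡-Reasoning
  open +-*-Solver
  Σ : ℚ
  Σ = ∑[ S ← allSubsets m ] (weight u A S * weight v S B)

weight-replicate : ∀ (w : Bool → Bool → ℚ) e → (∀ s → w s e ≡ 1ℚ) →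
                   ∀ {m} (S : Subset m) → weight w S (replicate m e) ≡ 1ℚ
weight-replicate w e w-e []      = refl
weight-replicate w e w-e (s ∷ S) = trans (cong₂ _*_ (w-e s) (weight-replicate w e w-e S)) (ℚP.*-identityˡ 1ℚ)

module _ (w : Bool → Bool → ℚ) (_⊕_ : Bool → Bool → Bool) (e : Bool)
         (w-⊕ : ∀ s a b → w s (a ⊕ b) ≡ w s a * w s b) (w-e : ∀ s → w s e ≡ 1ℚ) where

  weight-zipWith : ∀ {m} (S A B : Subset m) → weight w S (zipWith _⊕_ A B) ≡ weight w S A * weight w S B
  weight-zipWith []      []      []      = sym (ℚP.*-identityˡ 1ℚ)
  weight-zipWith (s ∷ S) (a ∷ A) (b ∷ B) =
    trans (cong₂ _*_ (w-⊕ s a b) (weight-zipWith S A B))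
          (solve 4 (λ x y z t → (x :* y) :* (z :* t) := (x :* z) :* (y :* t)) refl (w s a) (w s b) (weight w S A) (weight w S B))
    where open +-*-Solver

  weight-fold : ∀ {m} N (S : Subset m) (A : Fin N → Subset m) →
    weight w S (List.foldr (zipWith _⊕_) (replicate m e) (tabulate A)) ≡ prodFin N (λ l → weight w S (A l))
  weight-fold zero    S A = weight-replicate w e w-e S
  weight-fold (suc N) S A =
    trans (weight-zipWith S (A zero) _) (cong (weight w S (A zero) *_) (weight-fold N S (λ l → A (suc l))))

bit : Bool → ℚ
bit true  = 1ℚ
bit false = 0ℚ

⊆-w : Bool → Bool → ℚ
⊆-w true  t = bit t
⊆-w false t = 1ℚ

⟦_⊆_⟧ : ∀ {m} → Subset m → Subset m → ℚ
⟦_⊆_⟧ = weight ⊆-w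

≐-w : Bool → Bool → ℚ
≐-w true  x = bit x
≐-w false x = bit (not x)

⟦_≐_⟧ : ∀ {m} → Subset m → Subset m → ℚ
⟦_≐_⟧ = weight ≐-w

disjoint-w : Bool → Bool → ℚ
disjoint-w true  a = bit (not a)
disjoint-w false a = 1ℚ

disjoint : ∀ {m} → Subset m → Subset m → ℚ
disjoint = weight disjoint-w

-- ν R S = (-1)^∣S∣ [S ⊆ R] : the inclusion–exclusion weight
ν-w : Bool → Bool → ℚ
ν-w r     false = 1ℚ
ν-w true  true  = - 1ℚ
ν-w false true  = 0ℚ

ν : ∀ {m} → Subset m → Subset m → ℚ
ν = weight ν-w

-- μ D R = (-1)^∣R ∖ D∣ [D ⊆ R] : the Möbius function of the subset lattice
μ-w : Bool → Bool → ℚ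
μ-w true  true  = 1ℚ
μ-w true  false = 0ℚ
μ-w false true  = - 1ℚ
μ-w false false = 1ℚ

μ : ∀ {m} → Subset m → Subset m → ℚ
μ = weight μ-w

⊆-true : ∀ s → ⊆-w s true ≡ 1ℚ
⊆-true true  = refl
⊆-true false = refl

⊆-∧ : ∀ s a b → ⊆-w s (a ∧ b) ≡ ⊆-w s a * ⊆-w s b
⊆-∧ true  true  b = sym (ℚP.*-identityˡ (bit b))
⊆-∧ true  false b = sym (ℚP.*-zeroˡ (bit b))
⊆-∧ false a     b = sym (ℚP.*-identityˡ 1ℚ)

⊆-⊤ : ∀ {m} (R : Subset m) → ⟦ R ⊆ ⊤ ⟧ ≡ 1ℚ
⊆-⊤ = weight-replicate ⊆-w true ⊆-true

⊆-⋂ : ∀ {m} N (R : Subset m) (U : Fin N → Subset m) → ⟦ R ⊆ ⋂ (tabulate U) ⟧ ≡ prodFin N (λ d → ⟦ R ⊆ U d ⟧)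
⊆-⋂ = weight-fold ⊆-w _∧_ true ⊆-∧ ⊆-true

disjoint-⋃ : ∀ {m} N (S : Subset m) (A : Fin N → Subset m) →
             disjoint S (⋃ (tabulate A)) ≡ prodFin N (λ l → disjoint S (A l))
disjoint-⋃ = weight-fold disjoint-w _∨_ false disjoint-∨ disjoint-false
  where
  disjoint-∨ : ∀ s a b → disjoint-w s (a ∨ b) ≡ disjoint-w s a * disjoint-w s b
  disjoint-∨ true  true  b = sym (ℚP.*-zeroˡ (bit (not b)))
  disjoint-∨ true  false b = sym (ℚP.*-identityˡ (bit (not b)))
  disjoint-∨ false a     b = sym (ℚP.*-identityˡ 1ℚ)
  disjoint-false : ∀ s → disjoint-w s false ≡ 1ℚ
  disjoint-false true  = refl
  disjoint-false false = refl

disjoint-⊆∁ : ∀ {m} (S A : Subset m) → disjoint S A ≡ ⟦ A ⊆ ∁ S ⟧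
disjoint-⊆∁ []      []      = refl
disjoint-⊆∁ (s ∷ S) (a ∷ A) = cong₂ _*_ (coordinate s a) (disjoint-⊆∁ S A)
  where
  coordinate : ∀ s a → disjoint-w s a ≡ ⊆-w a (not s)
  coordinate true  true  = refl
  coordinate true  false = refl
  coordinate false true  = refl
  coordinate false false = refl

inclusion-exclusion : ∀ {m} (R U : Subset m) → ⟦ R ⊆ U ⟧ ≡ ∑[ S ← allSubsets m ] (ν R S * disjoint S U)
inclusion-exclusion R U = sym (trans (weight-compose ν-w disjoint-w R U) (weight-cong coordinate R U))
  where
  coordinate : ∀ r u → ν-w r true * disjoint-w true u + ν-w r false * disjoint-w false u ≡ ⊆-w r u
  coordinate true  true  = refl
  coordinate true  false = refl
  coordinate false true  = refl
  coordinate false false = refl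

möbius-inversion : ∀ {m} (D X : Subset m) → ⟦ D ≐ X ⟧ ≡ ∑[ R ← allSubsets m ] (μ D R * ⟦ R ⊆ X ⟧)
möbius-inversion D X = sym (trans (weight-compose μ-w ⊆-w D X) (weight-cong coordinate D X))
  where
  coordinate : ∀ d x → μ-w d true * ⊆-w true x + μ-w d false * ⊆-w false x ≡ ≐-w d x
  coordinate true  true  = refl
  coordinate true  false = refl
  coordinate false true  = refl
  coordinate false false = refl

subsets-binomial : ∀ {m} (T : Subset m) r →
  ∑[ R ← allSubsets m ] (𝟙 (∣ R ∣ ℕ.≟ r) * ⟦ R ⊆ T ⟧) ≡ ℕtoℚ (∣ T ∣ C r)
subsets-binomial {m} T r = trans (∑-cong (allSubsets m) flipped) (count T r)
  where
  flipped : ∀ R → 𝟙 (∣ R ∣ ℕ.≟ r) * ⟦ R ⊆ T ⟧ ≡ weight (flip ⊆-w) T R * 𝟙 (∣ R ∣ ℕ.≟ r)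
  flipped R = trans (ℚP.*-comm (𝟙 (∣ R ∣ ℕ.≟ r)) ⟦ R ⊆ T ⟧) (cong (_* 𝟙 (∣ R ∣ ℕ.≟ r)) (weight-flip ⊆-w R T))
  count : ∀ {m} (T : Subset m) r →
          ∑[ R ← allSubsets m ] (weight (flip ⊆-w) T R * 𝟙 (∣ R ∣ ℕ.≟ r)) ≡ ℕtoℚ (∣ T ∣ C r)
  count []      zero    = refl
  count []      (suc r) = refl
  count {suc m} (t ∷ T) r = trans (weight-step (flip ⊆-w) t T (λ R → 𝟙 (∣ R ∣ ℕ.≟ r))) (split t r)
    where
    Σ Σ⁺ : ℕ → ℚ
    Σ  s = ∑[ R ← allSubsets m ] (weight (flip ⊆-w) T R * 𝟙 (∣ R ∣ ℕ.≟ s))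
    Σ⁺ s = ∑[ R ← allSubsets m ] (weight (flip ⊆-w) T R * 𝟙 (suc ∣ R ∣ ℕ.≟ s))
    Σ⁺-zero : Σ⁺ zero ≡ 0ℚ
    Σ⁺-zero = trans (∑-cong (allSubsets m) (λ R → ℚP.*-zeroʳ (weight (flip ⊆-w) T R))) (∑-zero (allSubsets m))
    split : ∀ t r → bit t * Σ⁺ r + 1ℚ * Σ r ≡ ℕtoℚ (∣ t ∷ T ∣ C r)
    split false r = begin
      0ℚ * Σ⁺ r + 1ℚ * Σ r    ≡⟨ cong₂ _+_ (ℚP.*-zeroˡ (Σ⁺ r)) (ℚP.*-identityˡ (Σ r)) ⟩
      0ℚ + Σ r                ≡⟨ ℚP.+-identityˡ (Σ r) ⟩
      Σ r                     ≡⟨ count T r ⟩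
      ℕtoℚ (∣ T ∣ C r)        ∎
      where open ≡-Reasoning
    split true zero = begin
      1ℚ * Σ⁺ zero + 1ℚ * Σ zero   ≡⟨ cong₂ _+_ (trans (ℚP.*-identityˡ (Σ⁺ zero)) Σ⁺-zero)
                                               (trans (ℚP.*-identityˡ (Σ zero)) (count T zero)) ⟩
      0ℚ + ℕtoℚ 1                  ≡⟨ ℚP.+-identityˡ (ℕtoℚ 1) ⟩
      ℕtoℚ 1                       ∎
      where open ≡-Reasoning
    split true (suc r) = begin
      1ℚ * Σ⁺ (suc r) + 1ℚ * Σ (suc r)           ≡⟨ cong₂ _+_ (trans (ℚP.*-identityˡ (Σ r)) (count T r))
                                                               (trans (ℚP.*-identityˡ (Σ (suc r))) (count T (suc r))) ⟩
      ℕtoℚ (∣ T ∣ C r) + ℕtoℚ (∣ T ∣ C suc r)     ≡⟨ ℕtoℚ-+ (∣ T ∣ C r) (∣ T ∣ C suc r) ⟨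
      ℕtoℚ (∣ T ∣ C r ℕ.+ ∣ T ∣ C suc r)          ≡⟨ cong ℕtoℚ (nCk+nC[k+1]≡[n+1]C[k+1] ∣ T ∣ r) ⟩
      ℕtoℚ (suc ∣ T ∣ C suc r)                    ∎
      where open ≡-Reasoning

count-size : ∀ m r → ∑[ R ← allSubsets m ] 𝟙 (∣ R ∣ ℕ.≟ r) ≡ ℕtoℚ (m C r)
count-size m r = begin
  ∑[ R ← allSubsets m ] 𝟙 (∣ R ∣ ℕ.≟ r)               ≡⟨ ∑-cong (allSubsets m) include ⟩
  ∑[ R ← allSubsets m ] (𝟙 (∣ R ∣ ℕ.≟ r) * ⟦ R ⊆ ⊤ ⟧)  ≡⟨ subsets-binomial (⊤ {m}) r ⟩
  ℕtoℚ (∣ ⊤ {m} ∣ C r)                                ≡⟨ cong (λ s → ℕtoℚ (s C r)) (∣⊤∣≡n m) ⟩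
  ℕtoℚ (m C r)                                        ∎
  where
  open ≡-Reasoning
  include : ∀ R → 𝟙 (∣ R ∣ ℕ.≟ r) ≡ 𝟙 (∣ R ∣ ℕ.≟ r) * ⟦ R ⊆ ⊤ ⟧
  include R = sym (trans (cong (𝟙 (∣ R ∣ ℕ.≟ r) *_) (⊆-⊤ R)) (ℚP.*-identityʳ (𝟙 (∣ R ∣ ℕ.≟ r))))

∑-size : ∀ m r (g : ℕ → ℚ) → ∑[ R ← allSubsets m ] (𝟙 (∣ R ∣ ℕ.≟ r) * g ∣ R ∣) ≡ ℕtoℚ (m C r) * g r
∑-size m r g = begin
  ∑[ R ← allSubsets m ] (𝟙 (∣ R ∣ ℕ.≟ r) * g ∣ R ∣)  ≡⟨ ∑-cong (allSubsets m) (λ R → 𝟙-≡ (∣ R ∣ ℕ.≟ r) g) ⟩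
  ∑[ R ← allSubsets m ] (𝟙 (∣ R ∣ ℕ.≟ r) * g r)      ≡⟨ ∑-*ʳ (allSubsets m) (g r) (λ R → 𝟙 (∣ R ∣ ℕ.≟ r)) ⟩
  (∑[ R ← allSubsets m ] 𝟙 (∣ R ∣ ℕ.≟ r)) * g r      ≡⟨ cong (_* g r) (count-size m r) ⟩
  ℕtoℚ (m C r) * g r                                  ∎
  where open ≡-Reasoning

∑-≐ : ∀ {m} (X : Subset m) (g : Subset m → ℚ) → ∑[ D ← allSubsets m ] (⟦ D ≐ X ⟧ * g D) ≡ g X
∑-≐ {m} X g = trans (∑-cong (allSubsets m) (λ D → cong (_* g D) (weight-flip ≐-w D X))) (evaluate X g)
  where
  evaluate : ∀ {m} (X : Subset m) (g : Subset m → ℚ) →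
             ∑[ D ← allSubsets m ] (weight (flip ≐-w) X D * g D) ≡ g X
  evaluate []      g = trans (ℚP.+-identityʳ (1ℚ * g [])) (ℚP.*-identityˡ (g []))
  evaluate {suc m} (x ∷ X) g = trans (weight-step (flip ≐-w) x X g) (select x)
    where
    Σ : Bool → ℚ
    Σ b = ∑[ D ← allSubsets m ] (weight (flip ≐-w) X D * g (b ∷ D))
    select : ∀ x → bit x * Σ true + bit (not x) * Σ false ≡ g (x ∷ X)
    select true  = trans (cong₂ _+_ (ℚP.*-identityˡ (Σ true)) (ℚP.*-zeroˡ (Σ false)))
                         (trans (ℚP.+-identityʳ (Σ true)) (evaluate X (λ D → g (true ∷ D))))
    select false = trans (cong₂ _+_ (ℚP.*-zeroˡ (Σ true)) (ℚP.*-identityˡ (Σ false)))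
                         (trans (ℚP.+-identityˡ (Σ false)) (evaluate X (λ D → g (false ∷ D))))

ν-∇ : ∀ {m} (R : Subset m) (f : ℤ → ℚ) x →
      ∑[ S ← allSubsets m ] (ν R S * f (x ℤ.- + ∣ S ∣)) ≡ ∇^ (∣ R ∣) f x
ν-∇ []      f x = trans (ℚP.+-identityʳ (1ℚ * f (x ℤ.- + 0)))
                        (trans (ℚP.*-identityˡ (f (x ℤ.- + 0))) (cong f (ℤP.+-identityʳ x)))
ν-∇ {suc m} (r ∷ R) f x = begin
  ∑[ S ← allSubsets (suc m) ] (ν (r ∷ R) S * f (x ℤ.- + ∣ S ∣))
    ≡⟨ weight-step ν-w r R (λ S → f (x ℤ.- + ∣ S ∣)) ⟩
  ν-w r true * ∑[ S ← allSubsets m ] (ν R S * f (x ℤ.- + suc ∣ S ∣))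
    + 1ℚ * ∑[ S ← allSubsets m ] (ν R S * f (x ℤ.- + ∣ S ∣))
    ≡⟨ cong₂ (λ a b → ν-w r true * a + 1ℚ * b)
             (trans (∑-cong (allSubsets m) (λ S → cong (λ y → ν R S * f y) (step-down ∣ S ∣))) (ν-∇ R f (x ℤ.- + 1)))
             (ν-∇ R f x) ⟩
  ν-w r true * ∇^ (∣ R ∣) f (x ℤ.- + 1) + 1ℚ * ∇^ (∣ R ∣) f x
    ≡⟨ difference r ⟩
  ∇^ (∣ r ∷ R ∣) f x ∎
  where
  open ≡-Reasoning
  open +-*-Solver
  step-down : ∀ s → x ℤ.- + suc s ≡ (x ℤ.- + 1) ℤ.- + s
  step-down s = trans (cong (λ y → x ℤ.- y) (ℤP.pos-+ 1 s))
    (Z.solve 2 (λ x y → x Z.:- (Z.con (+ 1) Z.:+ y) Z.:= (x Z.:- Z.con (+ 1)) Z.:- y) refl x (+ s))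
    where module Z = ℤ-Solver
  difference : ∀ r → ν-w r true * ∇^ (∣ R ∣) f (x ℤ.- + 1) + 1ℚ * ∇^ (∣ R ∣) f x ≡ ∇^ (∣ r ∷ R ∣) f x
  difference true  = solve 2 (λ a b → con (- 1ℚ) :* a :+ con 1ℚ :* b := b :- a) refl
                             (∇^ (∣ R ∣) f (x ℤ.- + 1)) (∇^ (∣ R ∣) f x)
  difference false = solve 2 (λ a b → con 0ℚ :* a :+ con 1ℚ :* b := b) refl
                             (∇^ (∣ R ∣) f (x ℤ.- + 1)) (∇^ (∣ R ∣) f x)

Δ^-shift : ∀ j (h : ℕ → ℚ) y → Δ^ j h (suc y) ≡ Δ^ j (λ z → h (suc z)) y
Δ^-shift zero    h y = refl
Δ^-shift (suc j) h y = cong₂ _-_ (Δ^-shift j h (suc y)) (Δ^-shift j h y)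

Δ^-local : ∀ j {h h′ : ℕ → ℚ} → (∀ y → y ≤ j → h y ≡ h′ y) → Δ^ j h 0 ≡ Δ^ j h′ 0
Δ^-local zero    h≗h′ = h≗h′ 0 ℕ.z≤n
Δ^-local (suc j) {h} {h′} h≗h′ = begin
  Δ^ j h 1 - Δ^ j h 0                            ≡⟨ cong (_- Δ^ j h 0) (Δ^-shift j h 0) ⟩
  Δ^ j (λ z → h (suc z)) 0 - Δ^ j h 0            ≡⟨ cong₂ _-_ (Δ^-local j (λ y y≤j → h≗h′ (suc y) (s≤s y≤j)))
                                                             (Δ^-local j (λ y y≤j → h≗h′ y (ℕP.m≤n⇒m≤1+n y≤j))) ⟩
  Δ^ j (λ z → h′ (suc z)) 0 - Δ^ j h′ 0          ≡⟨ cong (_- Δ^ j h′ 0) (Δ^-shift j h′ 0) ⟨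
  Δ^ j h′ 1 - Δ^ j h′ 0                          ∎
  where open ≡-Reasoning

μ-Δ : ∀ {m} (D : Subset m) (g : ℕ → ℚ) →
      ∑[ R ← allSubsets m ] (μ D R * g ∣ R ∣) ≡ Δ^ ∣ ∁ D ∣ (λ y → g (m ∸ y)) 0
μ-Δ []      g = trans (ℚP.+-identityʳ (1ℚ * g 0)) (ℚP.*-identityˡ (g 0))
μ-Δ {suc m} (d ∷ D) g = begin
  ∑[ R ← allSubsets (suc m) ] (μ (d ∷ D) R * g ∣ R ∣)
    ≡⟨ weight-step μ-w d D (λ R → g ∣ R ∣) ⟩
  μ-w d true * ∑[ R ← allSubsets m ] (μ D R * g (suc ∣ R ∣))
    + μ-w d false * ∑[ R ← allSubsets m ] (μ D R * g ∣ R ∣)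
    ≡⟨ cong₂ (λ a b → μ-w d true * a + μ-w d false * b) (trans (μ-Δ D (λ s → g (suc s))) with-new) (μ-Δ D g) ⟩
  μ-w d true * Δ^ j h 0 + μ-w d false * Δ^ j (λ y → h (suc y)) 0
    ≡⟨ difference d ⟩
  Δ^ ∣ ∁ (d ∷ D) ∣ h 0 ∎
  where
  open ≡-Reasoning
  open +-*-Solver
  j : ℕ
  j = ∣ ∁ D ∣
  h : ℕ → ℚ
  h y = g (suc m ∸ y)
  -- the sum over the R containing the new element only sees y ≤ j ≤ m
  with-new : Δ^ j (λ y → g (suc (m ∸ y))) 0 ≡ Δ^ j h 0
  with-new = Δ^-local j (λ y y≤j → cong g (sym (ℕP.+-∸-assoc 1 (ℕP.≤-trans y≤j (∣p∣≤n (∁ D))))))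
  difference : ∀ d → μ-w d true * Δ^ j h 0 + μ-w d false * Δ^ j (λ y → h (suc y)) 0 ≡ Δ^ ∣ ∁ (d ∷ D) ∣ h 0
  difference true  = solve 2 (λ a b → con 1ℚ :* a :+ con 0ℚ :* b := a) refl
                             (Δ^ j h 0) (Δ^ j (λ y → h (suc y)) 0)
  difference false = trans (solve 2 (λ a b → con (- 1ℚ) :* a :+ con 1ℚ :* b := b :- a) refl
                                    (Δ^ j h 0) (Δ^ j (λ y → h (suc y)) 0))
                           (cong (_- Δ^ j h 0) (sym (Δ^-shift j h 0)))

∑-subsetsOfSize : ∀ m k (g : Subset m → ℚ) →
  ∑ (subsetsOfSize m k) g ≡ ∑[ A ← allSubsets m ] (𝟙 (∣ A ∣ ℕ.≟ k) * g A)
∑-subsetsOfSize m k = ∑-filter (λ A → ∣ A ∣ ℕ.≟ k) (allSubsets m)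

subsetsOfSize-length : ∀ m k → ℕtoℚ (length (subsetsOfSize m k)) ≡ ℕtoℚ (m C k)
subsetsOfSize-length m k = begin
  ℕtoℚ (length (subsetsOfSize m k))                  ≡⟨ length-∑ (subsetsOfSize m k) ⟩
  ∑[ A ← subsetsOfSize m k ] 1ℚ                       ≡⟨ ∑-subsetsOfSize m k (λ _ → 1ℚ) ⟩
  ∑[ A ← allSubsets m ] (𝟙 (∣ A ∣ ℕ.≟ k) * 1ℚ)        ≡⟨ ∑-cong (allSubsets m) (λ A → ℚP.*-identityʳ (𝟙 (∣ A ∣ ℕ.≟ k))) ⟩
  ∑[ A ← allSubsets m ] 𝟙 (∣ A ∣ ℕ.≟ k)               ≡⟨ count-size m k ⟩
  ℕtoℚ (m C k)                                        ∎
  where open ≡-Reasoning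

subsetsOfSize-nonempty : ∀ m k → k ≤ m → 1 ≤ length (subsetsOfSize m k)
subsetsOfSize-nonempty m k k≤m =
  ℕP.≤-trans (C-positive m k k≤m) (ℕP.≤-reflexive (sym (ℕtoℚ-injective (subsetsOfSize-length m k))))

-- The k-subsets of [m] avoiding S are the k-subsets of its complement.
avoiding-count : ∀ m k (S : Subset m) → ∑[ A ← subsetsOfSize m k ] disjoint S A ≡ ℕtoℚ (∣ ∁ S ∣ C k)
avoiding-count m k S = begin
  ∑[ A ← subsetsOfSize m k ] disjoint S A                ≡⟨ ∑-subsetsOfSize m k (disjoint S) ⟩
  ∑[ A ← allSubsets m ] (𝟙 (∣ A ∣ ℕ.≟ k) * disjoint S A)
    ≡⟨ ∑-cong (allSubsets m) (λ A → cong (𝟙 (∣ A ∣ ℕ.≟ k) *_) (disjoint-⊆∁ S A)) ⟩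
  ∑[ A ← allSubsets m ] (𝟙 (∣ A ∣ ℕ.≟ k) * ⟦ A ⊆ ∁ S ⟧) ≡⟨ subsets-binomial (∁ S) k ⟩
  ℕtoℚ (∣ ∁ S ∣ C k)                                    ∎
  where open ≡-Reasoning

complement-size : ∀ {m} (S : Subset m) → + m ℤ.- + ∣ S ∣ ≡ + ∣ ∁ S ∣
complement-size {m} S = trans (ℤP.[+m]-[+n]≡m⊖n m ∣ S ∣)
  (trans (ℤP.⊖-≥ (∣p∣≤n S)) (cong +_ (sym (∣∁p∣≡n∸∣p∣ S))))

∏-normalised : ∀ m N (k : Fin N → ℕ) → (∀ l → k l ≤ m) → ∀ x →
  prodFin N (λ l → ℕtoℚ (m C k l)) * prodFin N (λ l → gbinom x (k l) * recipℕ (m C k l))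
    ≡ prodFin N (λ l → gbinom x (k l))
∏-normalised m N k k≤m x = trans (sym (∏-* N _ _))
  (∏-cong N (λ l → ℕtoℚ-cancel (m C k l) (gbinom x (k l)) (C-positive m (k l) (k≤m l))))

uniform-average : ∀ N a e → 1 ≤ N → (a * (ℕtoℚ N * e)) * recipℕ N ≡ a * e
uniform-average N a e N≥1 = trans
  (solve 4 (λ a n e r → (a :* (n :* e)) :* r := n :* ((a :* e) :* r)) refl a (ℕtoℚ N) e (recipℕ N))
  (ℕtoℚ-cancel N (a * e) N≥1)
  where open +-*-Solver

module Committees (m c : ℕ) (n : Fin c → ℕ) (k : (d : Fin c) → Fin (n d) → ℕ)
                  (k≤m : ∀ d l → k d l ≤ m) where

  Ω-dept : (d : Fin c) → List (Fin (n d) → Subset m)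
  Ω-dept d = allChoices (n d) (λ l → subsetsOfSize m (k d l))

  X : Outcome m c n → Subset m
  X ω = ⋂ (tabulate (λ d → ⋃ (tabulate (ω d))))

  size : Fin c → ℚ
  size d = prodFin (n d) (λ l → ℕtoℚ (m C k d l))

  |Ω| : ℚ
  |Ω| = prodFin c size

  F : Fin c → ℤ → ℚ
  F = Fdep m c n k

  -- E r = ∏_d ∇ʳ F_d (m), so that E[C(X_∩, r)] = C(m, r) · E r
  E : ℕ → ℚ
  E r = prodFin c (λ d → ∇^ r (F d) (+ m))

  Ω-length : ℕtoℚ (length (Ω m c n k)) ≡ |Ω|
  Ω-length = trans (allChoices-length c Ω-dept)
    (∏-cong c (λ d → trans (allChoices-length (n d) (λ l → subsetsOfSize m (k d l)))
                           (∏-cong (n d) (λ l → subsetsOfSize-length m (k d l)))))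

  Ω-nonempty : 1 ≤ length (Ω m c n k)
  Ω-nonempty = allChoices-nonempty c Ω-dept (λ d →
    allChoices-nonempty (n d) (λ l → subsetsOfSize m (k d l)) (λ l → subsetsOfSize-nonempty m (k d l) (k≤m d l)))

  avoiding-configurations : ∀ d (S : Subset m) →
    ∑[ τ ← Ω-dept d ] disjoint S (⋃ (tabulate τ)) ≡ size d * F d (+ m ℤ.- + ∣ S ∣)
  avoiding-configurations d S = begin
    ∑[ τ ← Ω-dept d ] disjoint S (⋃ (tabulate τ))
      ≡⟨ ∑-cong (Ω-dept d) (disjoint-⋃ (n d) S) ⟩
    ∑[ τ ← Ω-dept d ] prodFin (n d) (λ l → disjoint S (τ l))
      ≡⟨ ∑-allChoices (n d) (λ l → subsetsOfSize m (k d l)) (λ l → disjoint S) ⟩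
    prodFin (n d) (λ l → ∑[ A ← subsetsOfSize m (k d l) ] disjoint S A)
      ≡⟨ ∏-cong (n d) (λ l → trans (avoiding-count m (k d l) S) (sym (gbinom-ℕ ∣ ∁ S ∣ (k d l)))) ⟩
    prodFin (n d) (λ l → gbinom (+ ∣ ∁ S ∣) (k d l))
      ≡⟨ cong (λ x → prodFin (n d) (λ l → gbinom x (k d l))) (complement-size S) ⟨
    prodFin (n d) (λ l → gbinom (+ m ℤ.- + ∣ S ∣) (k d l))
      ≡⟨ ∏-normalised m (n d) (k d) (k≤m d) (+ m ℤ.- + ∣ S ∣) ⟨
    size d * F d (+ m ℤ.- + ∣ S ∣) ∎
    where open ≡-Reasoning

  covering-configurations : ∀ d (R : Subset m) →
    ∑[ τ ← Ω-dept d ] ⟦ R ⊆ ⋃ (tabulate τ) ⟧ ≡ size d * ∇^ ∣ R ∣ (F d) (+ m)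
  covering-configurations d R = begin
    ∑[ τ ← Ω-dept d ] ⟦ R ⊆ ⋃ (tabulate τ) ⟧
      ≡⟨ ∑-cong (Ω-dept d) (λ τ → inclusion-exclusion R (⋃ (tabulate τ))) ⟩
    ∑[ τ ← Ω-dept d ] ∑[ S ← allSubsets m ] (ν R S * disjoint S (⋃ (tabulate τ)))
      ≡⟨ ∑-swap (Ω-dept d) (allSubsets m) _ ⟩
    ∑[ S ← allSubsets m ] ∑[ τ ← Ω-dept d ] (ν R S * disjoint S (⋃ (tabulate τ)))
      ≡⟨ ∑-cong (allSubsets m) (λ S → trans (∑-*ˡ (Ω-dept d) (ν R S) _) (cong (ν R S *_) (avoiding-configurations d S))) ⟩
    ∑[ S ← allSubsets m ] (ν R S * (size d * F d (+ m ℤ.- + ∣ S ∣)))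
      ≡⟨ ∑-*-middle (allSubsets m) (size d) (ν R) (λ S → F d (+ m ℤ.- + ∣ S ∣)) ⟩
    size d * ∑[ S ← allSubsets m ] (ν R S * F d (+ m ℤ.- + ∣ S ∣))
      ≡⟨ cong (size d *_) (ν-∇ R (F d) (+ m)) ⟩
    size d * ∇^ ∣ R ∣ (F d) (+ m) ∎
    where open ≡-Reasoning

  containing-configurations : ∀ (R : Subset m) → ∑[ ω ← Ω m c n k ] ⟦ R ⊆ X ω ⟧ ≡ |Ω| * E ∣ R ∣
  containing-configurations R = begin
    ∑[ ω ← Ω m c n k ] ⟦ R ⊆ X ω ⟧
      ≡⟨ ∑-cong (Ω m c n k) (λ ω → ⊆-⋂ c R (λ d → ⋃ (tabulate (ω d)))) ⟩
    ∑[ ω ← Ω m c n k ] prodFin c (λ d → ⟦ R ⊆ ⋃ (tabulate (ω d)) ⟧)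
      ≡⟨ ∑-allChoices c Ω-dept (λ d τ → ⟦ R ⊆ ⋃ (tabulate τ) ⟧) ⟩
    prodFin c (λ d → ∑[ τ ← Ω-dept d ] ⟦ R ⊆ ⋃ (tabulate τ) ⟧)
      ≡⟨ ∏-cong c (λ d → covering-configurations d R) ⟩
    prodFin c (λ d → size d * ∇^ ∣ R ∣ (F d) (+ m))
      ≡⟨ ∏-* c size (λ d → ∇^ ∣ R ∣ (F d) (+ m)) ⟩
    |Ω| * E ∣ R ∣ ∎
    where open ≡-Reasoning

  -- Σ_ω C(∣X ω∣, r) = Σ_{∣R∣ = r} #{ω : R ⊆ X ω}
  binomial-moment : ∀ r → ∑[ ω ← Ω m c n k ] ℕtoℚ (∣ X ω ∣ C r) ≡ ℕtoℚ (m C r) * (|Ω| * E r)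
  binomial-moment r = begin
    ∑[ ω ← Ω m c n k ] ℕtoℚ (∣ X ω ∣ C r)
      ≡⟨ ∑-cong (Ω m c n k) (λ ω → sym (subsets-binomial (X ω) r)) ⟩
    ∑[ ω ← Ω m c n k ] ∑[ R ← allSubsets m ] (𝟙 (∣ R ∣ ℕ.≟ r) * ⟦ R ⊆ X ω ⟧)
      ≡⟨ ∑-swap (Ω m c n k) (allSubsets m) _ ⟩
    ∑[ R ← allSubsets m ] ∑[ ω ← Ω m c n k ] (𝟙 (∣ R ∣ ℕ.≟ r) * ⟦ R ⊆ X ω ⟧)
      ≡⟨ ∑-cong (allSubsets m) (λ R → trans (∑-*ˡ (Ω m c n k) (𝟙 (∣ R ∣ ℕ.≟ r)) _)
                                             (cong (𝟙 (∣ R ∣ ℕ.≟ r) *_) (containing-configurations R))) ⟩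
    ∑[ R ← allSubsets m ] (𝟙 (∣ R ∣ ℕ.≟ r) * (|Ω| * E ∣ R ∣))
      ≡⟨ ∑-size m r (λ s → |Ω| * E s) ⟩
    ℕtoℚ (m C r) * (|Ω| * E r) ∎
    where open ≡-Reasoning

  h : ℕ → ℚ
  h y = E (m ∸ y)

  equal-configurations : ∀ (D : Subset m) → ∑[ ω ← Ω m c n k ] ⟦ D ≐ X ω ⟧ ≡ |Ω| * Δ^ (m ∸ ∣ D ∣) h 0
  equal-configurations D = begin
    ∑[ ω ← Ω m c n k ] ⟦ D ≐ X ω ⟧
      ≡⟨ ∑-cong (Ω m c n k) (λ ω → möbius-inversion D (X ω)) ⟩
    ∑[ ω ← Ω m c n k ] ∑[ R ← allSubsets m ] (μ D R * ⟦ R ⊆ X ω ⟧)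
      ≡⟨ ∑-swap (Ω m c n k) (allSubsets m) _ ⟩
    ∑[ R ← allSubsets m ] ∑[ ω ← Ω m c n k ] (μ D R * ⟦ R ⊆ X ω ⟧)
      ≡⟨ ∑-cong (allSubsets m) (λ R → trans (∑-*ˡ (Ω m c n k) (μ D R) _) (cong (μ D R *_) (containing-configurations R))) ⟩
    ∑[ R ← allSubsets m ] (μ D R * (|Ω| * E ∣ R ∣))
      ≡⟨ ∑-*-middle (allSubsets m) |Ω| (μ D) (λ R → E ∣ R ∣) ⟩
    |Ω| * ∑[ R ← allSubsets m ] (μ D R * E ∣ R ∣)
      ≡⟨ cong (|Ω| *_) (μ-Δ D E) ⟩
    |Ω| * Δ^ ∣ ∁ D ∣ h 0
      ≡⟨ cong (λ j → |Ω| * Δ^ j h 0) (∣∁p∣≡n∸∣p∣ D) ⟩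
    |Ω| * Δ^ (m ∸ ∣ D ∣) h 0 ∎
    where open ≡-Reasoning

  -- #{ω : ∣X ω∣ = i} = Σ_{∣D∣ = i} #{ω : X ω = D}
  exact-count : ∀ i → ℕtoℚ (length (filter (λ ω → Xcap ω ℕ.≟ i) (Ω m c n k)))
                        ≡ ℕtoℚ (m C i) * (|Ω| * Δ^ (m ∸ i) h 0)
  exact-count i = begin
    ℕtoℚ (length (filter (λ ω → Xcap ω ℕ.≟ i) (Ω m c n k)))
      ≡⟨ length-∑ (filter (λ ω → Xcap ω ℕ.≟ i) (Ω m c n k)) ⟩
    ∑[ ω ← filter (λ ω → Xcap ω ℕ.≟ i) (Ω m c n k) ] 1ℚ
      ≡⟨ ∑-filter (λ ω → Xcap ω ℕ.≟ i) (Ω m c n k) (λ _ → 1ℚ) ⟩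
    ∑[ ω ← Ω m c n k ] (𝟙 (∣ X ω ∣ ℕ.≟ i) * 1ℚ)
      ≡⟨ ∑-cong (Ω m c n k) (λ ω → trans (ℚP.*-identityʳ _) (sym (∑-≐ (X ω) (λ D → 𝟙 (∣ D ∣ ℕ.≟ i))))) ⟩
    ∑[ ω ← Ω m c n k ] ∑[ D ← allSubsets m ] (⟦ D ≐ X ω ⟧ * 𝟙 (∣ D ∣ ℕ.≟ i))
      ≡⟨ ∑-swap (Ω m c n k) (allSubsets m) _ ⟩
    ∑[ D ← allSubsets m ] ∑[ ω ← Ω m c n k ] (⟦ D ≐ X ω ⟧ * 𝟙 (∣ D ∣ ℕ.≟ i))
      ≡⟨ ∑-cong (allSubsets m) (λ D → trans (∑-*ʳ (Ω m c n k) (𝟙 (∣ D ∣ ℕ.≟ i)) _)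
           (trans (cong (_* 𝟙 (∣ D ∣ ℕ.≟ i)) (equal-configurations D)) (ℚP.*-comm _ (𝟙 (∣ D ∣ ℕ.≟ i))))) ⟩
    ∑[ D ← allSubsets m ] (𝟙 (∣ D ∣ ℕ.≟ i) * (|Ω| * Δ^ (m ∸ ∣ D ∣) h 0))
      ≡⟨ ∑-size m i (λ s → |Ω| * Δ^ (m ∸ s) h 0) ⟩
    ℕtoℚ (m C i) * (|Ω| * Δ^ (m ∸ i) h 0) ∎
    where open ≡-Reasoning

  average : ∀ a e → (a * (|Ω| * e)) * recipℕ (length (Ω m c n k)) ≡ a * e
  average a e = trans (cong (λ N → (a * (N * e)) * recipℕ (length (Ω m c n k))) (sym Ω-length))
                      (uniform-average (length (Ω m c n k)) a e Ω-nonempty)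

-- Corollary 2.13: divide the counts of exact-count and binomial-moment by
-- the number of outcomes ∣Ω∣.
corollary2p13 : (m c : ℕ) → 1 ≤ m → 1 ≤ c →
    (n : Fin c → ℕ) (k : (d : Fin c) → Fin (n d) → ℕ) →
    (∀ d l → k d l ≤ m) →
    ((i : ℕ) → i ≤ m →
      probXcap m c n k i ≡
        ℕtoℚ (m C i) * Δ^ (m ∸ i) (λ y → prodFin c (λ d → ∇^ (m ∸ y) (Fdep m c n k d) (+ m))) 0)
    × ((r : ℕ) →
      expBinomXcap m c n k r ≡
        ℕtoℚ (m C r) * prodFin c (λ d → ∇^ r (Fdep m c n k d) (+ m)))
corollary2p13 m c _ _ n k k≤m = distribution , moments
  where
  open Committees m c n k k≤m
  distribution : ∀ i → i ≤ m → probXcap m c n k i ≡ ℕtoℚ (m C i) * Δ^ (m ∸ i) h 0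
  distribution i _ = trans (cong (_* recipℕ (length (Ω m c n k))) (exact-count i))
                           (average (ℕtoℚ (m C i)) (Δ^ (m ∸ i) h 0))
  moments : ∀ r → expBinomXcap m c n k r ≡ ℕtoℚ (m C r) * E r
  moments r = trans (cong (_* recipℕ (length (Ω m c n k))) (binomial-moment r))
                    (average (ℕtoℚ (m C r)) (E r))
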